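{- The sequence $$s_{18}(n)=\sum_{k=0}^{n}(-1)^k\binom{n}{k}\binom{2k}{k}\binom{2(n-k)}{n-k}\binom{2n-3k}{n}\qquad(n\ge0)$$ satisfies the Lucas congruences: for every prime $p$ and every $n\ge0$ with base-$p$ expansion $n=n_0+n_1p+\cdots+n_rp^r$, $s_{18}(n)\equiv s_{18}(n_0)\cdots s_{18}(n_r)\pmod p$.
   Context: For integers $m\ge0$ and any number $x$, $\binom{x}{m}=\frac{x(x-1)\cdots(x-m+1)}{m!}$ (so the upper entry $2n-3k$ may be negative). Equivalently, $s_{18}(0)=1$ and for $n\ge1$, $s_{18}(n)=\sum_{k=0}^{\lfloor n/3\rfloor}(-1)^k\binom{n}{k}\binom{2k}{k}\binom{2(n-k)}{n-k}\bigl[\binom{2n-3k-1}{n}+\binom{2n-3k}{n}\bigr]$. -}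

module Defs where

open import Data.Nat as ℕ using (ℕ; zero; suc; _!; _∸_)
open import Data.Nat.Properties using (_!≢0)
open import Data.Nat.Combinatorics using (_C_)
open import Data.Integer as ℤ using (ℤ; +_; _/ℕ_; -1ℤ)
open import Data.List using (List; []; _∷_)

falling : ℤ → ℕ → ℤ
falling x zero    = + 1
falling x (suc m) = falling x m ℤ.* (x ℤ.- + m)

-- generalized binomial coefficient  binom(x, m) = x(x-1)...(x-m+1) / m!
-- (the division is exact; _/ℕ_ is integer division by the nonzero natural m!)
binomℤ : ℤ → ℕ → ℤ
binomℤ x m = falling x m /ℕ (m !)
  where instance _ = m !≢0

sumTo : ℕ → (ℕ → ℤ) → ℤ
sumTo zero    f = f 0
sumTo (suc n) f = sumTo n f ℤ.+ f (suc n)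

s18 : ℕ → ℤ
s18 n = sumTo n λ k →
  (-1ℤ ℤ.^ k) ℤ.* + (n C k) ℤ.* + ((2 ℕ.* k) C k)
    ℤ.* + ((2 ℕ.* (n ∸ k)) C (n ∸ k))
    ℤ.* binomℤ (+ (2 ℕ.* n) ℤ.- + (3 ℕ.* k)) n

baseVal : ℕ → List ℕ → ℕ
baseVal p []       = 0
baseVal p (d ∷ ds) = d ℕ.+ p ℕ.* baseVal p ds

prodS18 : List ℕ → ℤ
prodS18 []       = + 1
prodS18 (d ∷ ds) = s18 d ℤ.* prodS18 ds

-- Write binom x k for the binomial coefficient with integer upper entry x and
-- w(n,k) = (-1)^k C(n,k) C(2k,k) C(2(n-k),n-k), so s18(n) = Σ_k w(n,k) binom(2n-3k, n).
-- Lucas' theorem holds for integer upper entries, so for n = d + p m, k = k₀ + p k′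
-- with d, k₀ < p it gives w(n,k) ≡ w(d,k₀) w(m,k′) and, as 2n-3k = (2d-3k₀) + p(2m-3k′),
-- binom(2n-3k, n) ≡ binom(2d-3k₀, d) binom(2m-3k′-ε, m), where ε = 1 if the low digit
-- 2d-3k₀ is negative (it is then ≥ -p) and ε = 0 otherwise (it is then < p unless
-- w(d,k₀) ≡ 0). The borrow ε does not matter because Σ_k w(m,k) binom(2m-3k-1, m) = s18(m):
-- the difference Σ_k w(m,k) binom(2m-3k-1, m-1) vanishes, its terms cancelling under
-- k ↦ m-k by the reflection binom(x,t) = (-1)^t binom(t-1-x, t). Identities in the upper entry are proved by
-- induction over ℤ along forward differences, i.e. Pascal's rule.

module Submission where

open import Level using (0ℓ)
open import Data.Nat as ℕ using (ℕ; zero; suc; _∸_; _!; _<_; _≤_; _<?_; _≤?_)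
import Data.Nat.Properties as ℕ
import Data.Nat.DivMod as ℕ
open import Data.Nat.Combinatorics using (_C_; k>n⇒nCk≡0; nCk+nC[k+1]≡[n+1]C[k+1]; nCn≡1; nC1≡n; nCk≡nC[n∸k])
open import Data.Nat.Divisibility using (divides; ∣⇒≤) renaming (_∣_ to _∣ℕ_)
open import Data.Nat.Primality using (Prime; euclidsLemma; ¬prime[0])
open import Data.Nat.Tactic.RingSolver using () renaming (solve-∀ to ℕ-solve-∀)
open import Data.Integer as ℤ using (ℤ; +_; -[1+_]; -1ℤ; 0ℤ; 1ℤ; _+_; _-_; _*_; -_; _^_)
import Data.Integer.Properties as ℤ
open import Data.Integer.Divisibility using (_∣_)
open import Data.Integer.Divisibility.Signed as Signed
  using (∣ᵤ⇒∣; ∣⇒∣ᵤ; ∣-refl; ∣n⇒∣m*n; ∣m⇒∣m*n; ∣m⇒∣-m; ∣m∣n⇒∣m+n; ∣m∣n⇒∣m-n)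
open import Data.Integer.Tactic.RingSolver using (solve-∀)
open import Data.List using (List; []; _∷_)
open import Data.List.Relation.Unary.All using (All; []; _∷_)
open import Data.Product using (_×_; _,_)
open import Data.Sum using (_⊎_; inj₁; inj₂; [_,_]′)
open import Algebra.Definitions using (Congruent₂)
open import Relation.Binary.Core using (Rel)
open import Relation.Binary.Structures using (IsEquivalence)
open import Relation.Binary.Bundles using (Setoid)
import Relation.Binary.Reasoning.Setoid as SetoidReasoning
open import Relation.Binary.PropositionalEquality
open import Relation.Nullary using (yes; no; contradiction)
open import Defs

pos-∸ : ∀ {m n} → n ≤ m → + (m ∸ n) ≡ + m - + n
pos-∸ {m} {n} n≤m = sym (trans (ℤ.[+m]-[+n]≡m⊖n m n) (ℤ.⊖-≥ n≤m))

-1^[m∸k] : ∀ {m k} → k ≤ m → -1ℤ ^ (m ∸ k) ≡ -1ℤ ^ m * -1ℤ ^ k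
-1^[m∸k] {m} ℕ.z≤n = sym (ℤ.*-identityʳ (-1ℤ ^ m))
-1^[m∸k] (ℕ.s≤s {k} {m} k≤m) = trans (-1^[m∸k] k≤m) (lemma (-1ℤ ^ m) (-1ℤ ^ k))
  where lemma : ∀ a b → a * b ≡ -1ℤ * a * (-1ℤ * b)
        lemma = solve-∀

-1^m*-1^m≡1 : ∀ m → (-1ℤ ^ m) * (-1ℤ ^ m) ≡ 1ℤ
-1^m*-1^m≡1 zero    = refl
-1^m*-1^m≡1 (suc m) = trans (lemma (-1ℤ ^ m)) (-1^m*-1^m≡1 m)
  where lemma : ∀ a → -1ℤ * a * (-1ℤ * a) ≡ a * a
        lemma = solve-∀

Σ< : ℕ → (ℕ → ℤ) → ℤ
Σ< zero    f = 0ℤ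
Σ< (suc N) f = Σ< N f + f N

sumTo≡Σ< : ∀ n f → sumTo n f ≡ Σ< (suc n) f
sumTo≡Σ< zero    f = sym (ℤ.+-identityˡ (f 0))
sumTo≡Σ< (suc n) f = cong (_+ f (suc n)) (sumTo≡Σ< n f)

ℤ-induction : ∀ {ℓ} (P : ℤ → Set ℓ) → P 0ℤ → (∀ x → P x → P (ℤ.suc x)) → (∀ x → P (ℤ.suc x) → P x) → ∀ x → P x
ℤ-induction P base up down (+ zero)      = base
ℤ-induction P base up down (+ suc n)     = up (+ n) (ℤ-induction P base up down (+ n))
ℤ-induction P base up down -[1+ zero ]   = down -[1+ 0 ] base
ℤ-induction P base up down -[1+ suc n ]  = down -[1+ suc n ] (ℤ-induction P base up down -[1+ n ])

module Congruence {ℓ} {_~_ : Rel ℤ ℓ} (isEquivalence : IsEquivalence _~_)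
                  (+-cong : Congruent₂ _~_ _+_) (−-cong : Congruent₂ _~_ _-_) where

  open IsEquivalence isEquivalence using (reflexive) renaming (trans to ~-trans)

  Δ-induction : (f g : ℤ → ℤ) → f 0ℤ ~ g 0ℤ → (∀ x → (f (ℤ.suc x) - f x) ~ (g (ℤ.suc x) - g x)) → ∀ x → f x ~ g x
  Δ-induction f g base Δ~ = ℤ-induction (λ x → f x ~ g x) base up down
    where
    undo-Δ : ∀ a b → a ≡ (a - b) + b
    undo-Δ = solve-∀
    undo-Δ′ : ∀ a b → b ≡ a - (a - b)
    undo-Δ′ = solve-∀
    up : ∀ x → f x ~ g x → f (ℤ.suc x) ~ g (ℤ.suc x)
    up x fx~gx = ~-trans (reflexive (undo-Δ _ (f x))) (~-trans (+-cong (Δ~ x) fx~gx) (reflexive (sym (undo-Δ _ (g x)))))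
    down : ∀ x → f (ℤ.suc x) ~ g (ℤ.suc x) → f x ~ g x
    down x fx′~gx′ = ~-trans (reflexive (undo-Δ′ (f (ℤ.suc x)) (f x))) (~-trans (−-cong fx′~gx′ (Δ~ x)) (reflexive (sym (undo-Δ′ (g (ℤ.suc x)) (g x)))))

  Σ<-cong : ∀ N {f g : ℕ → ℤ} → (∀ k → k < N → f k ~ g k) → Σ< N f ~ Σ< N g
  Σ<-cong zero    f~g = reflexive refl
  Σ<-cong (suc N) f~g = +-cong (Σ<-cong N (λ k k<N → f~g k (ℕ.m<n⇒m<1+n k<N))) (f~g N (ℕ.n<1+n N))

open Congruence {_~_ = _≡_} isEquivalence (cong₂ _+_) (cong₂ _-_) using (Δ-induction; Σ<-cong)

Σ<-+ : ∀ N (f g : ℕ → ℤ) → Σ< N (λ k → f k + g k) ≡ Σ< N f + Σ< N g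
Σ<-+ zero    f g = refl
Σ<-+ (suc N) f g = trans (cong (_+ (f N + g N)) (Σ<-+ N f g)) (lemma (Σ< N f) (Σ< N g) (f N) (g N))
  where lemma : ∀ a b c d → a + b + (c + d) ≡ a + c + (b + d)
        lemma = solve-∀

Σ<-neg : ∀ N (f : ℕ → ℤ) → Σ< N (λ k → - f k) ≡ - Σ< N f
Σ<-neg zero    f = refl
Σ<-neg (suc N) f = trans (cong (_+ - f N) (Σ<-neg N f)) (sym (ℤ.neg-distrib-+ (Σ< N f) (f N)))

Σ<-sub : ∀ N (f g : ℕ → ℤ) → Σ< N (λ k → f k - g k) ≡ Σ< N f - Σ< N g
Σ<-sub N f g = trans (Σ<-+ N f (λ k → - g k)) (cong (λ t → Σ< N f + t) (Σ<-neg N g))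

Σ<-distribˡ : ∀ N c (f : ℕ → ℤ) → c * Σ< N f ≡ Σ< N (λ k → c * f k)
Σ<-distribˡ zero    c f = ℤ.*-zeroʳ c
Σ<-distribˡ (suc N) c f = trans (ℤ.*-distribˡ-+ c (Σ< N f) (f N)) (cong (_+ c * f N) (Σ<-distribˡ N c f))

Σ<-distribʳ : ∀ N c (f : ℕ → ℤ) → Σ< N f * c ≡ Σ< N (λ k → f k * c)
Σ<-distribʳ N c f = trans (ℤ.*-comm (Σ< N f) c) (trans (Σ<-distribˡ N c f) (Σ<-cong N (λ k _ → ℤ.*-comm c (f k))))

Σ<-first : ∀ N (f : ℕ → ℤ) → Σ< (suc N) f ≡ f 0 + Σ< N (λ k → f (suc k))
Σ<-first zero    f = trans (ℤ.+-identityˡ (f 0)) (sym (ℤ.+-identityʳ (f 0)))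
Σ<-first (suc N) f = trans (cong (_+ f (suc N)) (Σ<-first N f)) (ℤ.+-assoc (f 0) (Σ< N (λ k → f (suc k))) (f (suc N)))

Σ<-reverse : ∀ N (f : ℕ → ℤ) → Σ< N f ≡ Σ< N (λ k → f (N ∸ suc k))
Σ<-reverse zero    f = refl
Σ<-reverse (suc N) f = begin
  Σ< N f + f N                                ≡⟨ cong (_+ f N) (Σ<-reverse N f) ⟩
  Σ< N (λ k → f (N ∸ suc k)) + f N            ≡⟨ ℤ.+-comm (Σ< N (λ k → f (N ∸ suc k))) (f N) ⟩
  f N + Σ< N (λ k → f (N ∸ suc k))            ≡⟨ Σ<-first N (λ k → f (N ∸ k)) ⟨
  Σ< (suc N) (λ k → f (N ∸ k))                ∎
  where open ≡-Reasoning

Σ<-split : ∀ a b (f : ℕ → ℤ) → Σ< (a ℕ.+ b) f ≡ Σ< a f + Σ< b (λ k → f (a ℕ.+ k))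
Σ<-split a zero    f = trans (cong (λ t → Σ< t f) (ℕ.+-identityʳ a)) (sym (ℤ.+-identityʳ (Σ< a f)))
Σ<-split a (suc b) f = begin
  Σ< (a ℕ.+ suc b) f                                       ≡⟨ cong (λ t → Σ< t f) (ℕ.+-suc a b) ⟩
  Σ< (a ℕ.+ b) f + f (a ℕ.+ b)                             ≡⟨ cong (_+ f (a ℕ.+ b)) (Σ<-split a b f) ⟩
  Σ< a f + Σ< b (λ k → f (a ℕ.+ k)) + f (a ℕ.+ b)          ≡⟨ ℤ.+-assoc (Σ< a f) (Σ< b (λ k → f (a ℕ.+ k))) (f (a ℕ.+ b)) ⟩
  Σ< a f + Σ< (suc b) (λ k → f (a ℕ.+ k))                  ∎
  where open ≡-Reasoning

Σ<-zeros : ∀ N → Σ< N (λ _ → 0ℤ) ≡ 0ℤ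
Σ<-zeros zero    = refl
Σ<-zeros (suc N) = trans (ℤ.+-identityʳ (Σ< N (λ _ → 0ℤ))) (Σ<-zeros N)

Σ<-swap : ∀ A B (f : ℕ → ℕ → ℤ) → Σ< A (λ i → Σ< B (f i)) ≡ Σ< B (λ j → Σ< A (λ i → f i j))
Σ<-swap zero    B f = sym (Σ<-zeros B)
Σ<-swap (suc A) B f = trans (cong (_+ Σ< B (f A)) (Σ<-swap A B f)) (sym (Σ<-+ B (λ j → Σ< A (λ i → f i j)) (f A)))

Σ<-extend : ∀ {N M} (f : ℕ → ℤ) → N ≤ M → (∀ k → N ≤ k → f k ≡ 0ℤ) → Σ< M f ≡ Σ< N f
Σ<-extend {N} {M} f N≤M vanishes = begin
  Σ< M f                                   ≡⟨ cong (λ t → Σ< t f) (ℕ.m+[n∸m]≡n N≤M) ⟨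
  Σ< (N ℕ.+ (M ∸ N)) f                     ≡⟨ Σ<-split N (M ∸ N) f ⟩
  Σ< N f + Σ< (M ∸ N) (λ k → f (N ℕ.+ k))   ≡⟨ cong (λ t → Σ< N f + t) (trans (Σ<-cong (M ∸ N) (λ k _ → vanishes (N ℕ.+ k) (ℕ.m≤m+n N k))) (Σ<-zeros (M ∸ N))) ⟩
  Σ< N f + 0ℤ                              ≡⟨ ℤ.+-identityʳ (Σ< N f) ⟩
  Σ< N f                                   ∎
  where open ≡-Reasoning

Σ<-blocks : ∀ q M (f : ℕ → ℤ) → Σ< (q ℕ.* M) f ≡ Σ< M (λ j → Σ< q (λ i → f (i ℕ.+ q ℕ.* j)))
Σ<-blocks q zero    f = cong (λ t → Σ< t f) (ℕ.*-zeroʳ q)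
Σ<-blocks q (suc M) f = begin
  Σ< (q ℕ.* suc M) f                                         ≡⟨ cong (λ t → Σ< t f) (trans (ℕ.*-suc q M) (ℕ.+-comm q (q ℕ.* M))) ⟩
  Σ< (q ℕ.* M ℕ.+ q) f                                       ≡⟨ Σ<-split (q ℕ.* M) q f ⟩
  Σ< (q ℕ.* M) f + Σ< q (λ i → f (q ℕ.* M ℕ.+ i))             ≡⟨ cong₂ _+_ (Σ<-blocks q M f) (Σ<-cong q (λ i _ → cong f (ℕ.+-comm (q ℕ.* M) i))) ⟩
  Σ< (suc M) (λ j → Σ< q (λ i → f (i ℕ.+ q ℕ.* j)))          ∎
  where open ≡-Reasoning

binom : ℤ → ℕ → ℤ
binom (+ n)    k = + (n C k)
binom -[1+ n ] k = (-1ℤ ^ k) * + ((n ℕ.+ k) C k)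

binom-zeroʳ : ∀ x → binom x 0 ≡ 1ℤ
binom-zeroʳ (+ n)    = refl
binom-zeroʳ -[1+ n ] = refl

n<k⇒binom≡0 : ∀ {n k} → n < k → binom (+ n) k ≡ 0ℤ
n<k⇒binom≡0 n<k = cong +_ (k>n⇒nCk≡0 n<k)

binom-pascal : ∀ x k → binom (ℤ.suc x) (suc k) ≡ binom x (suc k) + binom x k
binom-pascal (+ n) k = begin
  + (suc n C suc k)             ≡⟨ cong +_ (nCk+nC[k+1]≡[n+1]C[k+1] n k) ⟨
  + (n C k ℕ.+ n C suc k)       ≡⟨ ℤ.pos-+ (n C k) (n C suc k) ⟩
  + (n C k) + + (n C suc k)     ≡⟨ ℤ.+-comm (+ (n C k)) (+ (n C suc k)) ⟩
  + (n C suc k) + + (n C k)     ∎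
  where open ≡-Reasoning
binom-pascal -[1+ zero ] k
  rewrite nCn≡1 k | nCn≡1 (suc k) = lemma (-1ℤ ^ k)
  where lemma : ∀ s → 0ℤ ≡ -1ℤ * s * + 1 + s * + 1
        lemma = solve-∀
binom-pascal -[1+ suc n ] k = begin
  -1ℤ * s * + ((n ℕ.+ suc k) C suc k)                                   ≡⟨ lemma s (+ A) (+ B) ⟩
  -1ℤ * s * (+ A + + B) + s * + A                                       ≡⟨ cong₂ (λ u v → -1ℤ * s * u + s * v) sum shift ⟩
  -1ℤ * s * + ((suc n ℕ.+ suc k) C suc k) + s * + ((suc n ℕ.+ k) C k)   ∎
  where
  open ≡-Reasoning
  s = -1ℤ ^ k
  A = (n ℕ.+ suc k) C k
  B = (n ℕ.+ suc k) C suc k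
  lemma : ∀ s a b → -1ℤ * s * b ≡ -1ℤ * s * (a + b) + s * a
  lemma = solve-∀
  sum : + A + + B ≡ + ((suc n ℕ.+ suc k) C suc k)
  sum = trans (sym (ℤ.pos-+ A B)) (cong +_ (nCk+nC[k+1]≡[n+1]C[k+1] (n ℕ.+ suc k) k))
  shift : + A ≡ + ((suc n ℕ.+ k) C k)
  shift = cong (λ t → + (t C k)) (ℕ.+-suc n k)

binom-Δ : ∀ x k → binom (ℤ.suc x) (suc k) - binom x (suc k) ≡ binom x k
binom-Δ x k = trans (cong (_- binom x (suc k)) (binom-pascal x k)) (lemma (binom x (suc k)) (binom x k))
  where lemma : ∀ a b → a + b - a ≡ b
        lemma = solve-∀

binom-Δ-+ : ∀ x y k → binom (ℤ.suc x + y) (suc k) - binom (x + y) (suc k) ≡ binom (x + y) k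
binom-Δ-+ x y k = trans (cong (λ t → binom t (suc k) - binom (x + y) (suc k)) (ℤ.+-assoc 1ℤ x y)) (binom-Δ (x + y) k)

binom-oneʳ : ∀ x → binom x 1 ≡ x
binom-oneʳ (+ n)    = cong +_ (nC1≡n n)
binom-oneʳ -[1+ n ] = trans (cong (λ t → -1ℤ * 1ℤ * + t) (trans (cong (_C 1) (ℕ.+-comm n 1)) (nC1≡n (suc n))))
                           (lemma (+ suc n))
  where lemma : ∀ a → -1ℤ * 1ℤ * a ≡ - a
        lemma = solve-∀

binom-minus-oneˡ : ∀ k → binom -1ℤ k ≡ -1ℤ ^ k
binom-minus-oneˡ k = trans (cong (λ t → (-1ℤ ^ k) * + t) (nCn≡1 k)) (ℤ.*-identityʳ (-1ℤ ^ k))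

binom-absorb : ∀ k x → + suc k * binom x (suc k) ≡ (x - + k) * binom x k
binom-absorb zero x = begin
  1ℤ * binom x 1        ≡⟨ ℤ.*-identityˡ (binom x 1) ⟩
  binom x 1             ≡⟨ binom-oneʳ x ⟩
  x                     ≡⟨ lemma x ⟩
  (x - + 0) * 1ℤ        ≡⟨ cong ((x - + 0) *_) (binom-zeroʳ x) ⟨
  (x - + 0) * binom x 0 ∎
  where open ≡-Reasoning
        lemma : ∀ x → x ≡ (x - + 0) * 1ℤ
        lemma = solve-∀
binom-absorb (suc k) = Δ-induction (λ x → + suc (suc k) * binom x (suc (suc k))) (λ x → (x - + suc k) * binom x (suc k))
                                   (trans (ℤ.*-zeroʳ (+ suc (suc k))) (sym (ℤ.*-zeroʳ (0ℤ - + suc k)))) Δ-equal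
  where
  open ≡-Reasoning
  Δ-equal : ∀ x → + suc (suc k) * binom (ℤ.suc x) (suc (suc k)) - + suc (suc k) * binom x (suc (suc k))
                ≡ (ℤ.suc x - + suc k) * binom (ℤ.suc x) (suc k) - (x - + suc k) * binom x (suc k)
  Δ-equal x = begin
    K * binom (ℤ.suc x) (suc (suc k)) - K * binom x (suc (suc k))  ≡⟨ lemma₁ K (binom (ℤ.suc x) (suc (suc k))) (binom x (suc (suc k))) ⟩
    K * (binom (ℤ.suc x) (suc (suc k)) - binom x (suc (suc k)))    ≡⟨ cong (K *_) (binom-Δ x (suc k)) ⟩
    K * b₁                                                        ≡⟨ lemma₂ (+ k) b₁ ⟩
    b₁ + + suc k * b₁                                             ≡⟨ cong (λ t → b₁ + t) (binom-absorb k x) ⟩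
    b₁ + (x - + k) * b₀                                           ≡⟨ lemma₃ x (+ k) b₁ b₀ ⟩
    (ℤ.suc x - + suc k) * (b₁ + b₀) - (x - + suc k) * b₁           ≡⟨ cong (λ t → (ℤ.suc x - + suc k) * t - (x - + suc k) * b₁) (binom-pascal x k) ⟨
    (ℤ.suc x - + suc k) * binom (ℤ.suc x) (suc k) - (x - + suc k) * b₁ ∎
    where
    K = + suc (suc k)
    b₁ = binom x (suc k)
    b₀ = binom x k
    lemma₁ : ∀ c a b → c * a - c * b ≡ c * (a - b)
    lemma₁ = solve-∀
    lemma₂ : ∀ k b → (1ℤ + (1ℤ + k)) * b ≡ b + (1ℤ + k) * b
    lemma₂ = solve-∀
    lemma₃ : ∀ x k b₁ b₀ → b₁ + (x - k) * b₀ ≡ (1ℤ + x - (1ℤ + k)) * (b₁ + b₀) - (x - (1ℤ + k)) * b₁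
    lemma₃ = solve-∀

binom-absorb-suc : ∀ k x → + suc k * binom (ℤ.suc x) (suc k) ≡ ℤ.suc x * binom x k
binom-absorb-suc k x = begin
  + suc k * binom (ℤ.suc x) (suc k)              ≡⟨ cong (+ suc k *_) (binom-pascal x k) ⟩
  + suc k * (binom x (suc k) + binom x k)        ≡⟨ ℤ.*-distribˡ-+ (+ suc k) (binom x (suc k)) (binom x k) ⟩
  + suc k * binom x (suc k) + + suc k * binom x k ≡⟨ cong (_+ + suc k * binom x k) (binom-absorb k x) ⟩
  (x - + k) * binom x k + + suc k * binom x k     ≡⟨ lemma x (+ k) (binom x k) ⟩
  ℤ.suc x * binom x k                            ∎
  where open ≡-Reasoning
        lemma : ∀ x k b → (x - k) * b + (1ℤ + k) * b ≡ (1ℤ + x) * b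
        lemma = solve-∀

falling≡k!*binom : ∀ x k → falling x k ≡ + (k !) * binom x k
falling≡k!*binom x zero = sym (trans (ℤ.*-identityˡ (binom x 0)) (binom-zeroʳ x))
falling≡k!*binom x (suc k) = begin
  falling x k * (x - + k)                 ≡⟨ cong (_* (x - + k)) (falling≡k!*binom x k) ⟩
  + (k !) * binom x k * (x - + k)         ≡⟨ lemma₁ (+ (k !)) (binom x k) (x - + k) ⟩
  + (k !) * ((x - + k) * binom x k)       ≡⟨ cong (+ (k !) *_) (binom-absorb k x) ⟨
  + (k !) * (+ suc k * binom x (suc k))   ≡⟨ lemma₂ (+ (k !)) (+ suc k) (binom x (suc k)) ⟩
  + suc k * + (k !) * binom x (suc k)     ≡⟨ cong (_* binom x (suc k)) (ℤ.pos-* (suc k) (k !)) ⟨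
  + (suc k !) * binom x (suc k)           ∎
  where open ≡-Reasoning
        lemma₁ : ∀ a b c → a * b * c ≡ a * (c * b)
        lemma₁ = solve-∀
        lemma₂ : ∀ a b c → a * (b * c) ≡ b * a * c
        lemma₂ = solve-∀

[n*m]/n≡m : ∀ n m → (suc n ℕ.* m) ℕ./ suc n ≡ m
[n*m]/n≡m n m = trans (cong (ℕ._/ suc n) (ℕ.*-comm (suc n) m)) (ℕ.m*n/n≡m m (suc n))

[n*x]/n≡x : ∀ n x .{{_ : ℕ.NonZero n}} → (+ n * x) ℤ./ℕ n ≡ x
[n*x]/n≡x (suc n) (+ zero)  = cong (ℤ._/ℕ suc n) (ℤ.*-zeroʳ (+ suc n))
[n*x]/n≡x (suc n) (+ suc b) = cong +_ ([n*m]/n≡m n (suc b))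
[n*x]/n≡x (suc n) -[1+ b ] with suc (b ℕ.+ n ℕ.* suc b) ℕ.% suc n in r≡
... | zero   = cong (λ t → - + t) ([n*m]/n≡m n (suc b))
... | suc r  = contradiction (trans (sym (trans (cong (ℕ._% suc n) (ℕ.*-comm (suc n) (suc b))) (ℕ.m*n%n≡0 (suc b) (suc n)))) r≡)
                             ℕ.0≢1+n

binomℤ≡binom : ∀ x k → binomℤ x k ≡ binom x k
binomℤ≡binom x k = trans (cong (λ t → (t ℤ./ℕ (k !)) {{k ℕ.!≢0}}) (falling≡k!*binom x k))
                         ([n*x]/n≡x (k !) (binom x k) {{k ℕ.!≢0}})

binom-reflect : ∀ t x → binom x t ≡ (-1ℤ ^ t) * binom (+ t - 1ℤ - x) t
binom-reflect zero x = trans (binom-zeroʳ x) (sym (trans (ℤ.*-identityˡ _) (binom-zeroʳ (+ 0 - 1ℤ - x))))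
binom-reflect (suc t) = Δ-induction (λ x → binom x (suc t)) (λ x → (-1ℤ ^ suc t) * binom (+ suc t - 1ℤ - x) (suc t))
                                    (sym base) Δ-equal
  where
  open ≡-Reasoning
  s = -1ℤ ^ t
  base : (-1ℤ ^ suc t) * binom (+ suc t - 1ℤ - 0ℤ) (suc t) ≡ 0ℤ
  base = begin
    (-1ℤ ^ suc t) * binom (+ suc t - 1ℤ - 0ℤ) (suc t) ≡⟨ cong (λ u → (-1ℤ ^ suc t) * binom u (suc t)) (lemma (+ t)) ⟩
    (-1ℤ ^ suc t) * binom (+ t) (suc t)              ≡⟨ cong ((-1ℤ ^ suc t) *_) (n<k⇒binom≡0 (ℕ.n<1+n t)) ⟩
    (-1ℤ ^ suc t) * 0ℤ                               ≡⟨ ℤ.*-zeroʳ (-1ℤ ^ suc t) ⟩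
    0ℤ                                               ∎
    where lemma : ∀ u → (1ℤ + u) - 1ℤ - 0ℤ ≡ u
          lemma = solve-∀
  Δ-equal : ∀ x → binom (ℤ.suc x) (suc t) - binom x (suc t)
                ≡ (-1ℤ ^ suc t) * binom (+ suc t - 1ℤ - ℤ.suc x) (suc t) - (-1ℤ ^ suc t) * binom (+ suc t - 1ℤ - x) (suc t)
  Δ-equal x = begin
    binom (ℤ.suc x) (suc t) - binom x (suc t)            ≡⟨ binom-Δ x t ⟩
    binom x t                                            ≡⟨ binom-reflect t x ⟩
    s * binom (+ t - 1ℤ - x) t                           ≡⟨ cong (λ u → s * binom u t) (lemma₁ (+ t) x) ⟩
    s * binom z t                                        ≡⟨ cong (s *_) (binom-Δ z t) ⟨
    s * (binom (ℤ.suc z) (suc t) - binom z (suc t))       ≡⟨ lemma₂ s (binom z (suc t)) (binom (ℤ.suc z) (suc t)) ⟩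
    -1ℤ * s * binom z (suc t) - -1ℤ * s * binom (ℤ.suc z) (suc t)
      ≡⟨ cong (λ u → -1ℤ * s * binom z (suc t) - -1ℤ * s * binom u (suc t)) (lemma₃ (+ t) x) ⟩
    (-1ℤ ^ suc t) * binom z (suc t) - (-1ℤ ^ suc t) * binom (+ suc t - 1ℤ - x) (suc t) ∎
    where
    z = + suc t - 1ℤ - ℤ.suc x
    lemma₁ : ∀ t x → t - 1ℤ - x ≡ (1ℤ + t) - 1ℤ - (1ℤ + x)
    lemma₁ = solve-∀
    lemma₂ : ∀ s a b → s * (b - a) ≡ -1ℤ * s * a - -1ℤ * s * b
    lemma₂ = solve-∀
    lemma₃ : ∀ t x → 1ℤ + ((1ℤ + t) - 1ℤ - (1ℤ + x)) ≡ (1ℤ + t) - 1ℤ - x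
    lemma₃ = solve-∀

central : ℕ → ℤ
central k = + ((2 ℕ.* k) C k)

weight : ℕ → ℕ → ℤ
weight n k = (-1ℤ ^ k) * + (n C k) * central k * central (n ∸ k)

top : ℕ → ℕ → ℤ
top n k = + (2 ℕ.* n) - + (3 ℕ.* k)

term : ℕ → ℕ → ℤ
term n k = weight n k * binom (top n k) n

term⁻ : ℕ → ℕ → ℤ
term⁻ n k = weight n k * binom (top n k - 1ℤ) n

s18≡Σ<term : ∀ n → s18 n ≡ Σ< (suc n) (term n)
s18≡Σ<term n = trans (sumTo≡Σ< n _) (Σ<-cong (suc n) (λ k _ → cong (weight n k *_) (binomℤ≡binom (top n k) n)))

weight-vanishes : ∀ {n k} → n < k → weight n k ≡ 0ℤ
weight-vanishes {n} {k} n<k = begin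
  (-1ℤ ^ k) * + (n C k) * central k * central (n ∸ k)  ≡⟨ cong (λ t → (-1ℤ ^ k) * t * central k * central (n ∸ k)) (n<k⇒binom≡0 n<k) ⟩
  (-1ℤ ^ k) * 0ℤ * central k * central (n ∸ k)         ≡⟨ lemma (-1ℤ ^ k) (central k) (central (n ∸ k)) ⟩
  0ℤ                                                   ∎
  where open ≡-Reasoning
        lemma : ∀ s a b → s * 0ℤ * a * b ≡ 0ℤ
        lemma = solve-∀

term-vanishes : ∀ {n k} → n < k → term n k ≡ 0ℤ
term-vanishes {n} {k} n<k = trans (cong (_* binom (top n k) n) (weight-vanishes n<k)) (ℤ.*-zeroˡ (binom (top n k) n))

weight-reflect : ∀ {m k} → k ≤ m → weight m (m ∸ k) ≡ (-1ℤ ^ m) * weight m k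
weight-reflect {m} {k} k≤m = begin
  (-1ℤ ^ (m ∸ k)) * + (m C (m ∸ k)) * central (m ∸ k) * central (m ∸ (m ∸ k))
    ≡⟨ cong₂ (λ s t → s * + (m C (m ∸ k)) * central (m ∸ k) * central t) (-1^[m∸k] k≤m) (ℕ.m∸[m∸n]≡n k≤m) ⟩
  (-1ℤ ^ m) * (-1ℤ ^ k) * + (m C (m ∸ k)) * central (m ∸ k) * central k
    ≡⟨ cong (λ t → (-1ℤ ^ m) * (-1ℤ ^ k) * + t * central (m ∸ k) * central k) (nCk≡nC[n∸k] k≤m) ⟨
  (-1ℤ ^ m) * (-1ℤ ^ k) * + (m C k) * central (m ∸ k) * central k
    ≡⟨ lemma (-1ℤ ^ m) (-1ℤ ^ k) (+ (m C k)) (central (m ∸ k)) (central k) ⟩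
  (-1ℤ ^ m) * weight m k
    ∎
  where open ≡-Reasoning
        lemma : ∀ a s b x y → a * s * b * x * y ≡ a * (s * b * y * x)
        lemma = solve-∀

top-reflect : ∀ m k → k ≤ suc m → + m - 1ℤ - (top (suc m) (suc m ∸ k) - 1ℤ) ≡ top (suc m) k - 1ℤ
top-reflect m k k≤M = begin
  + m - 1ℤ - (+ (2 ℕ.* suc m) - + (3 ℕ.* (suc m ∸ k)) - 1ℤ)        ≡⟨ cong₂ (λ u v → + m - 1ℤ - (u - v - 1ℤ)) (ℤ.pos-* 2 (suc m)) (ℤ.pos-* 3 (suc m ∸ k)) ⟩
  + m - 1ℤ - (+ 2 * + suc m - + 3 * + (suc m ∸ k) - 1ℤ)            ≡⟨ cong (λ u → + m - 1ℤ - (+ 2 * + suc m - + 3 * u - 1ℤ)) (pos-∸ k≤M) ⟩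
  + m - 1ℤ - (+ 2 * + suc m - + 3 * (+ suc m - + k) - 1ℤ)          ≡⟨ lemma (+ m) (+ k) ⟩
  + 2 * + suc m - + 3 * + k - 1ℤ                                  ≡⟨ cong₂ (λ u v → u - v - 1ℤ) (ℤ.pos-* 2 (suc m)) (ℤ.pos-* 3 k) ⟨
  + (2 ℕ.* suc m) - + (3 ℕ.* k) - 1ℤ                                ∎
  where open ≡-Reasoning
        lemma : ∀ m k → m - 1ℤ - (+ 2 * (1ℤ + m) - + 3 * ((1ℤ + m) - k) - 1ℤ) ≡ + 2 * (1ℤ + m) - + 3 * k - 1ℤ
        lemma = solve-∀

Δterm : ℕ → ℕ → ℤ
Δterm m k = weight (suc m) k * binom (top (suc m) k - 1ℤ) m

term-term⁻ : ∀ m k → term (suc m) k - term⁻ (suc m) k ≡ Δterm m k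
term-term⁻ m k = begin
  w * binom y (suc m) - w * binom (y - 1ℤ) (suc m)                     ≡⟨ lemma₁ w (binom y (suc m)) (binom (y - 1ℤ) (suc m)) ⟩
  w * (binom y (suc m) - binom (y - 1ℤ) (suc m))                      ≡⟨ cong (λ u → w * (binom u (suc m) - binom (y - 1ℤ) (suc m))) (lemma₂ y) ⟩
  w * (binom (ℤ.suc (y - 1ℤ)) (suc m) - binom (y - 1ℤ) (suc m))       ≡⟨ cong (w *_) (binom-Δ (y - 1ℤ) m) ⟩
  w * binom (y - 1ℤ) m                                                ∎
  where open ≡-Reasoning
        w = weight (suc m) k
        y = top (suc m) k
        lemma₁ : ∀ w a b → w * a - w * b ≡ w * (a - b)
        lemma₁ = solve-∀
        lemma₂ : ∀ y → y ≡ 1ℤ + (y - 1ℤ)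
        lemma₂ = solve-∀

Δterm-antisymmetric : ∀ m k → k ≤ suc m → Δterm m (suc m ∸ k) ≡ - Δterm m k
Δterm-antisymmetric m k k≤M = begin
  weight M j * binom (top M j - 1ℤ) m                            ≡⟨ cong₂ _*_ (weight-reflect k≤M) (binom-reflect m (top M j - 1ℤ)) ⟩
  (-1ℤ ^ M) * weight M k * ((-1ℤ ^ m) * binom (+ m - 1ℤ - (top M j - 1ℤ)) m)
                                                                 ≡⟨ cong (λ u → (-1ℤ ^ M) * weight M k * ((-1ℤ ^ m) * binom u m)) (top-reflect m k k≤M) ⟩
  -1ℤ * (-1ℤ ^ m) * weight M k * ((-1ℤ ^ m) * binom (top M k - 1ℤ) m) ≡⟨ lemma (-1ℤ ^ m) (weight M k) (binom (top M k - 1ℤ) m) ⟩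
  - ((-1ℤ ^ m) * (-1ℤ ^ m)) * (weight M k * binom (top M k - 1ℤ) m)  ≡⟨ cong (λ u → - u * Δterm m k) (-1^m*-1^m≡1 m) ⟩
  - 1ℤ * Δterm m k                                                ≡⟨ ℤ.-1*i≡-i (Δterm m k) ⟩
  - Δterm m k                                                     ∎
  where
  open ≡-Reasoning
  M = suc m
  j = M ∸ k
  lemma : ∀ s w b → -1ℤ * s * w * (s * b) ≡ - (s * s) * (w * b)
  lemma = solve-∀

Σ<Δterm≡0 : ∀ m → Σ< (suc (suc m)) (Δterm m) ≡ 0ℤ
Σ<Δterm≡0 m = self-negative (begin
  S                                              ≡⟨ Σ<-reverse (suc (suc m)) (Δterm m) ⟩
  Σ< (suc (suc m)) (λ k → Δterm m (suc m ∸ k))   ≡⟨ Σ<-cong (suc (suc m)) (λ k k<M → Δterm-antisymmetric m k (ℕ.≤-pred k<M)) ⟩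
  Σ< (suc (suc m)) (λ k → - Δterm m k)           ≡⟨ Σ<-neg (suc (suc m)) (Δterm m) ⟩
  - S                                            ∎)
  where
  open ≡-Reasoning
  S = Σ< (suc (suc m)) (Δterm m)
  self-negative : ∀ {a} → a ≡ - a → a ≡ 0ℤ
  self-negative {a} a≡-a = ℤ.*-cancelˡ-≡ (+ 2) a 0ℤ (trans (lemma₁ a) (trans (cong (λ t → a + t) a≡-a) (lemma₂ a)))
    where lemma₁ : ∀ a → + 2 * a ≡ a + a
          lemma₁ = solve-∀
          lemma₂ : ∀ a → a + - a ≡ + 2 * 0ℤ
          lemma₂ = solve-∀

Σ<term⁻≡Σ<term : ∀ m → Σ< (suc m) (term⁻ m) ≡ Σ< (suc m) (term m)
Σ<term⁻≡Σ<term zero = cong (λ b → 0ℤ + weight 0 0 * b) (trans (binom-zeroʳ (top 0 0 - 1ℤ)) (sym (binom-zeroʳ (top 0 0))))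
Σ<term⁻≡Σ<term (suc m) = sym (ℤ.i-j≡0⇒i≡j _ _ (begin
  Σ< (suc (suc m)) (term (suc m)) - Σ< (suc (suc m)) (term⁻ (suc m))  ≡⟨ Σ<-sub (suc (suc m)) (term (suc m)) (term⁻ (suc m)) ⟨
  Σ< (suc (suc m)) (λ k → term (suc m) k - term⁻ (suc m) k)          ≡⟨ Σ<-cong (suc (suc m)) (λ k _ → term-term⁻ m k) ⟩
  Σ< (suc (suc m)) (Δterm m)                                          ≡⟨ Σ<Δterm≡0 m ⟩
  0ℤ                                                                  ∎))
  where open ≡-Reasoning

module Modulo (q : ℕ) where

  infix 4 _≈_
  -- A record rather than a definition, so that a and b can be inferred from a ≈ b.
  record _≈_ (a b : ℤ) : Set where
    constructor [_]
    field divides-difference : + q Signed.∣ a - b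

  private
    ≈-resp : ∀ {x a b} → x ≡ a - b → + q Signed.∣ x → a ≈ b
    ≈-resp x≡a-b q∣x = [ subst (+ q Signed.∣_) x≡a-b q∣x ]

  ∣⇒≈0 : ∀ {a} → + q Signed.∣ a → a ≈ 0ℤ
  ∣⇒≈0 {a} = ≈-resp (sym (ℤ.+-identityʳ a))

  ≈-isEquivalence : IsEquivalence _≈_
  ≈-isEquivalence = record { refl = ≈-refl′ ; sym = ≈-sym′ ; trans = ≈-trans′ }
    where
    ≈-refl′ : ∀ {a} → a ≈ a
    ≈-refl′ {a} = ≈-resp (sym (ℤ.+-inverseʳ a)) (∣n⇒∣m*n 0ℤ ∣-refl)
    ≈-sym′ : ∀ {a b} → a ≈ b → b ≈ a
    ≈-sym′ {a} {b} [ a≈b ] = ≈-resp (lemma a b) (∣m⇒∣-m a≈b)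
      where lemma : ∀ a b → - (a - b) ≡ b - a
            lemma = solve-∀
    ≈-trans′ : ∀ {a b c} → a ≈ b → b ≈ c → a ≈ c
    ≈-trans′ {a} {b} {c} [ a≈b ] [ b≈c ] = ≈-resp (lemma a b c) (∣m∣n⇒∣m+n a≈b b≈c)
      where lemma : ∀ a b c → (a - b) + (b - c) ≡ a - c
            lemma = solve-∀

  ≈-setoid : Setoid 0ℓ 0ℓ
  ≈-setoid = record { isEquivalence = ≈-isEquivalence }

  module ≈-Reasoning = SetoidReasoning ≈-setoid

  open IsEquivalence ≈-isEquivalence public using () renaming (refl to ≈-refl; sym to ≈-sym; trans to ≈-trans; reflexive to ≡⇒≈)

  +-cong : Congruent₂ _≈_ _+_
  +-cong {a} {b} {c} {d} [ a≈b ] [ c≈d ] = ≈-resp (lemma a b c d) (∣m∣n⇒∣m+n a≈b c≈d)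
    where lemma : ∀ a b c d → (a - b) + (c - d) ≡ (a + c) - (b + d)
          lemma = solve-∀

  −-cong : Congruent₂ _≈_ _-_
  −-cong {a} {b} {c} {d} [ a≈b ] [ c≈d ] = ≈-resp (lemma a b c d) (∣m∣n⇒∣m-n a≈b c≈d)
    where lemma : ∀ a b c d → (a - b) - (c - d) ≡ (a - c) - (b - d)
          lemma = solve-∀

  *-cong : Congruent₂ _≈_ _*_
  *-cong {a} {b} {c} {d} [ a≈b ] [ c≈d ] = ≈-resp (lemma a b c d) (∣m∣n⇒∣m+n (∣m⇒∣m*n c a≈b) (∣n⇒∣m*n b c≈d))
    where lemma : ∀ a b c d → (a - b) * c + b * (c - d) ≡ a * c - b * d
          lemma = solve-∀

  ≈0⇒*≈0 : ∀ {a} b → a ≈ 0ℤ → a * b ≈ 0ℤ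
  ≈0⇒*≈0 b a≈0 = ≈-trans (*-cong a≈0 (≈-refl {b})) (≡⇒≈ (ℤ.*-zeroˡ b))

  ≈0⇒*≈0′ : ∀ a {b} → b ≈ 0ℤ → a * b ≈ 0ℤ
  ≈0⇒*≈0′ a b≈0 = ≈-trans (*-cong (≈-refl {a}) b≈0) (≡⇒≈ (ℤ.*-zeroʳ a))

  open Congruence ≈-isEquivalence +-cong −-cong public renaming (Δ-induction to Δ-induction≈; Σ<-cong to Σ<-cong≈)

module Lucas (p-1 : ℕ) (p-prime : Prime (suc p-1)) where

  p : ℕ
  p = suc p-1

  P : ℤ
  P = + p

  open Modulo p public

  binom-p≈0 : ∀ k → suc k < p → binom P (suc k) ≈ 0ℤ
  binom-p≈0 k k+1<p = [ (λ p∣k+1 → contradiction (∣⇒≤ p∣k+1) (ℕ.<⇒≱ k+1<p)) , (λ p∣pCk+1 → ∣⇒≈0 (∣ᵤ⇒∣ p∣pCk+1)) ]′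
                        (euclidsLemma (suc k) (p C suc k) p-prime p∣[k+1]*pCk+1)
    where
    absorbed : suc k ℕ.* (p C suc k) ≡ (p-1 C k) ℕ.* p
    absorbed = ℤ.+-injective (begin
      + (suc k ℕ.* (p C suc k))      ≡⟨ ℤ.pos-* (suc k) (p C suc k) ⟩
      + suc k * binom P (suc k)      ≡⟨ binom-absorb-suc k (+ p-1) ⟩
      P * binom (+ p-1) k            ≡⟨ ℤ.*-comm P (binom (+ p-1) k) ⟩
      + (p-1 C k) * P                ≡⟨ ℤ.pos-* (p-1 C k) p ⟨
      + ((p-1 C k) ℕ.* p)            ∎)
        where open ≡-Reasoning
    p∣[k+1]*pCk+1 : p ∣ℕ suc k ℕ.* (p C suc k)
    p∣[k+1]*pCk+1 = divides (p-1 C k) absorbed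

  binom-+p : ∀ k → k < p → ∀ x → binom (x + P) k ≈ binom x k
  binom-+p zero    _     x = ≡⇒≈ (trans (binom-zeroʳ (x + P)) (sym (binom-zeroʳ x)))
  binom-+p (suc k) k+1<p   = Δ-induction≈ (λ x → binom (x + P) (suc k)) (λ x → binom x (suc k)) (binom-p≈0 k k+1<p) Δ≈
    where
    open ≈-Reasoning
    Δ≈ : ∀ x → binom (ℤ.suc x + P) (suc k) - binom (x + P) (suc k) ≈ binom (ℤ.suc x) (suc k) - binom x (suc k)
    Δ≈ x = begin
      binom (ℤ.suc x + P) (suc k) - binom (x + P) (suc k)  ≡⟨ binom-Δ-+ x P k ⟩
      binom (x + P) k                                      ≈⟨ binom-+p k (ℕ.<-trans (ℕ.n<1+n k) k+1<p) x ⟩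
      binom x k                                            ≡⟨ binom-Δ x k ⟨
      binom (ℤ.suc x) (suc k) - binom x (suc k)            ∎

  binom-+p-beyond : ∀ k x → binom (x + P) (k ℕ.+ p) ≈ binom x (k ℕ.+ p) + binom x k
  binom-+p-beyond zero = Δ-induction≈ (λ x → binom (x + P) p) (λ x → binom x p + binom x 0) (≡⇒≈ (cong +_ (nCn≡1 p))) Δ≈
    where
    open ≈-Reasoning
    Δ≈ : ∀ x → binom (ℤ.suc x + P) p - binom (x + P) p ≈ (binom (ℤ.suc x) p + binom (ℤ.suc x) 0) - (binom x p + binom x 0)
    Δ≈ x = begin
      binom (ℤ.suc x + P) p - binom (x + P) p                          ≡⟨ binom-Δ-+ x P p-1 ⟩
      binom (x + P) p-1                                                ≈⟨ binom-+p p-1 (ℕ.n<1+n p-1) x ⟩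
      binom x p-1                                                      ≡⟨ binom-Δ x p-1 ⟨
      binom (ℤ.suc x) p - binom x p                                    ≡⟨ lemma (binom (ℤ.suc x) p) (binom x p) ⟩
      (binom (ℤ.suc x) p + 1ℤ) - (binom x p + 1ℤ)                      ≡⟨ cong₂ (λ u v → (binom (ℤ.suc x) p + u) - (binom x p + v)) (binom-zeroʳ (ℤ.suc x)) (binom-zeroʳ x) ⟨
      (binom (ℤ.suc x) p + binom (ℤ.suc x) 0) - (binom x p + binom x 0) ∎
      where lemma : ∀ a b → a - b ≡ (a + 1ℤ) - (b + 1ℤ)
            lemma = solve-∀
  binom-+p-beyond (suc k) = Δ-induction≈ (λ x → binom (x + P) (suc k ℕ.+ p)) (λ x → binom x (suc k ℕ.+ p) + binom x (suc k))
                                         (≡⇒≈ (n<k⇒binom≡0 {p} {suc k ℕ.+ p} (ℕ.m<n+m p ℕ.z<s))) Δ≈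
    where
    open ≈-Reasoning
    Δ≈ : ∀ x → binom (ℤ.suc x + P) (suc k ℕ.+ p) - binom (x + P) (suc k ℕ.+ p)
             ≈ (binom (ℤ.suc x) (suc k ℕ.+ p) + binom (ℤ.suc x) (suc k)) - (binom x (suc k ℕ.+ p) + binom x (suc k))
    Δ≈ x = begin
      binom (ℤ.suc x + P) (suc k ℕ.+ p) - binom (x + P) (suc k ℕ.+ p)       ≡⟨ binom-Δ-+ x P (k ℕ.+ p) ⟩
      binom (x + P) (k ℕ.+ p)                                              ≈⟨ binom-+p-beyond k x ⟩
      binom x (k ℕ.+ p) + binom x k
        ≡⟨ cong₂ _+_ (binom-Δ x (k ℕ.+ p)) (binom-Δ x k) ⟨
      (binom (ℤ.suc x) (suc k ℕ.+ p) - binom x (suc k ℕ.+ p)) + (binom (ℤ.suc x) (suc k) - binom x (suc k))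
        ≡⟨ lemma (binom (ℤ.suc x) (suc k ℕ.+ p)) (binom x (suc k ℕ.+ p)) (binom (ℤ.suc x) (suc k)) (binom x (suc k)) ⟩
      (binom (ℤ.suc x) (suc k ℕ.+ p) + binom (ℤ.suc x) (suc k)) - (binom x (suc k ℕ.+ p) + binom x (suc k)) ∎
      where lemma : ∀ a b c d → (a - b) + (c - d) ≡ (a + c) - (b + d)
            lemma = solve-∀

  binom-periodic : ∀ k → k < p → ∀ x b → binom (x + P * b) k ≈ binom x k
  binom-periodic k k<p x = Δ-induction≈ (λ b → binom (x + P * b) k) (λ _ → binom x k)
                                        (≡⇒≈ (cong (λ t → binom t k) (lemma₁ x P))) Δ≈
    where
    open ≈-Reasoning
    lemma₁ : ∀ x p → x + p * 0ℤ ≡ x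
    lemma₁ = solve-∀
    lemma₂ : ∀ x p b → x + p * (1ℤ + b) ≡ (x + p * b) + p
    lemma₂ = solve-∀
    Δ≈ : ∀ b → binom (x + P * ℤ.suc b) k - binom (x + P * b) k ≈ binom x k - binom x k
    Δ≈ b = begin
      binom (x + P * ℤ.suc b) k - binom y k  ≡⟨ cong (λ t → binom t k - binom y k) (lemma₂ x P b) ⟩
      binom (y + P) k - binom y k            ≈⟨ −-cong (binom-+p k k<p y) ≈-refl ⟩
      binom y k - binom y k                  ≡⟨ ℤ.+-inverseʳ (binom y k) ⟩
      0ℤ                                     ≡⟨ ℤ.+-inverseʳ (binom x k) ⟨
      binom x k - binom x k                  ∎
      where y = x + P * b

  k+p*0≡k : ∀ k → k ℕ.+ p ℕ.* 0 ≡ k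
  k+p*0≡k k = trans (cong (k ℕ.+_) (ℕ.*-zeroʳ p)) (ℕ.+-identityʳ k)

  lucas : ∀ {a c} → a < p → c < p → ∀ d b → binom (+ a + P * b) (c ℕ.+ p ℕ.* d) ≈ binom (+ a) c * binom b d
  lucas {a} {c} a<p c<p zero b = begin
    binom (+ a + P * b) (c ℕ.+ p ℕ.* 0)  ≡⟨ cong (binom (+ a + P * b)) (k+p*0≡k c) ⟩
    binom (+ a + P * b) c               ≈⟨ binom-periodic c c<p (+ a) b ⟩
    binom (+ a) c                       ≡⟨ ℤ.*-identityʳ (binom (+ a) c) ⟨
    binom (+ a) c * 1ℤ                  ≡⟨ cong (binom (+ a) c *_) (binom-zeroʳ b) ⟨
    binom (+ a) c * binom b 0           ∎
    where open ≈-Reasoning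
  lucas {a} {c} a<p c<p (suc d) b = ≈-trans (≡⇒≈ (cong (binom (+ a + P * b)) (lemma c p d))) (carry b)
    where
    open ≈-Reasoning
    lemma : ∀ c p d → c ℕ.+ p ℕ.* suc d ≡ (c ℕ.+ p ℕ.* d) ℕ.+ p
    lemma = ℕ-solve-∀
    K = c ℕ.+ p ℕ.* d
    base : binom (+ a + P * 0ℤ) (K ℕ.+ p) ≈ binom (+ a) c * binom 0ℤ (suc d)
    base = begin
      binom (+ a + P * 0ℤ) (K ℕ.+ p)  ≡⟨ cong (λ t → binom (+ a + t) (K ℕ.+ p)) (ℤ.*-zeroʳ P) ⟩
      binom (+ a + 0ℤ) (K ℕ.+ p)      ≡⟨ cong (λ t → binom t (K ℕ.+ p)) (ℤ.+-identityʳ (+ a)) ⟩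
      binom (+ a) (K ℕ.+ p)           ≡⟨ n<k⇒binom≡0 (ℕ.<-≤-trans a<p (ℕ.m≤n+m p K)) ⟩
      0ℤ                              ≡⟨ ℤ.*-zeroʳ (binom (+ a) c) ⟨
      binom (+ a) c * 0ℤ              ∎
    Δ≈ : ∀ b → binom (+ a + P * ℤ.suc b) (K ℕ.+ p) - binom (+ a + P * b) (K ℕ.+ p)
             ≈ binom (+ a) c * binom (ℤ.suc b) (suc d) - binom (+ a) c * binom b (suc d)
    Δ≈ b = begin
      binom (+ a + P * ℤ.suc b) (K ℕ.+ p) - binom y (K ℕ.+ p)  ≡⟨ cong (λ t → binom t (K ℕ.+ p) - binom y (K ℕ.+ p)) (lemma′ (+ a) P b) ⟩
      binom (y + P) (K ℕ.+ p) - binom y (K ℕ.+ p)              ≈⟨ −-cong (binom-+p-beyond K y) ≈-refl ⟩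
      binom y (K ℕ.+ p) + binom y K - binom y (K ℕ.+ p)        ≡⟨ lemma″ (binom y (K ℕ.+ p)) (binom y K) ⟩
      binom y K                                                ≈⟨ lucas a<p c<p d b ⟩
      binom (+ a) c * binom b d                                ≡⟨ cong (binom (+ a) c *_) (binom-Δ b d) ⟨
      binom (+ a) c * (binom (ℤ.suc b) (suc d) - binom b (suc d))
        ≡⟨ lemma‴ (binom (+ a) c) (binom (ℤ.suc b) (suc d)) (binom b (suc d)) ⟩
      binom (+ a) c * binom (ℤ.suc b) (suc d) - binom (+ a) c * binom b (suc d) ∎
      where
      y = + a + P * b
      lemma′ : ∀ a p b → a + p * (1ℤ + b) ≡ (a + p * b) + p
      lemma′ = solve-∀
      lemma″ : ∀ u v → u + v - u ≡ v
      lemma″ = solve-∀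
      lemma‴ : ∀ u v w → u * (v - w) ≡ u * v - u * w
      lemma‴ = solve-∀
    carry : ∀ b → binom (+ a + P * b) (K ℕ.+ p) ≈ binom (+ a) c * binom b (suc d)
    carry = Δ-induction≈ (λ b → binom (+ a + P * b) (K ℕ.+ p)) (λ b → binom (+ a) c * binom b (suc d)) base Δ≈

  pos-digits : ∀ a b → + (a ℕ.+ p ℕ.* b) ≡ + a + P * + b
  pos-digits a b = trans (ℤ.pos-+ a (p ℕ.* b)) (cong (λ t → + a + t) (ℤ.pos-* p b))

  lucasℕ : ∀ {a c} → a < p → c < p → ∀ b d → binom (+ (a ℕ.+ p ℕ.* b)) (c ℕ.+ p ℕ.* d) ≈ binom (+ a) c * binom (+ b) d
  lucasℕ {a} a<p c<p b d = ≈-trans (≡⇒≈ (cong (λ t → binom t _) (pos-digits a b))) (lucas a<p c<p d (+ b))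

  lucas-vanishes : ∀ {a c} → a < c → c < p → ∀ b d → binom (+ (a ℕ.+ p ℕ.* b)) (c ℕ.+ p ℕ.* d) ≈ 0ℤ
  lucas-vanishes {a} {c} a<c c<p b d = ≈-trans (lucasℕ (ℕ.<-trans a<c c<p) c<p b d)
                                               (≡⇒≈ (trans (cong (_* binom (+ b) d) (n<k⇒binom≡0 a<c)) (ℤ.*-zeroˡ (binom (+ b) d))))

  sign-lucas : ∀ {k} → k < p → ∀ k′ → -1ℤ ^ (k ℕ.+ p ℕ.* k′) ≈ (-1ℤ ^ k) * (-1ℤ ^ k′)
  sign-lucas {k} k<p k′ = begin
    -1ℤ ^ (k ℕ.+ p ℕ.* k′)                       ≡⟨ binom-minus-oneˡ (k ℕ.+ p ℕ.* k′) ⟨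
    binom -1ℤ (k ℕ.+ p ℕ.* k′)                   ≡⟨ cong (λ t → binom t (k ℕ.+ p ℕ.* k′)) (lemma₁ (+ p-1)) ⟨
    binom (+ p-1 + P * -1ℤ) (k ℕ.+ p ℕ.* k′)     ≈⟨ lucas (ℕ.n<1+n p-1) k<p k′ -1ℤ ⟩
    binom (+ p-1) k * binom -1ℤ k′               ≡⟨ cong (λ t → binom t k * binom -1ℤ k′) (lemma₂ (+ p-1)) ⟨
    binom (-1ℤ + P) k * binom -1ℤ k′             ≈⟨ *-cong (binom-+p k k<p -1ℤ) ≈-refl ⟩
    binom -1ℤ k * binom -1ℤ k′                   ≡⟨ cong₂ _*_ (binom-minus-oneˡ k) (binom-minus-oneˡ k′) ⟩
    (-1ℤ ^ k) * (-1ℤ ^ k′)                       ∎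
    where
    open ≈-Reasoning
    lemma₁ : ∀ x → x + (1ℤ + x) * -1ℤ ≡ -1ℤ
    lemma₁ = solve-∀
    lemma₂ : ∀ x → -1ℤ + (1ℤ + x) ≡ x
    lemma₂ = solve-∀

  module _ {k : ℕ} (k<p : k < p) (p≤2k : p ≤ 2 ℕ.* k) where

    private
      e = 2 ℕ.* k ∸ p

      e+p≡2k : e ℕ.+ p ≡ 2 ℕ.* k
      e+p≡2k = ℕ.m∸n+n≡m p≤2k

      e<k : e < k
      e<k = ℕ.+-cancelʳ-< p e k (subst (_< k ℕ.+ p) (sym e+p≡2k) (subst (_< k ℕ.+ p) (lemma k) (ℕ.+-monoʳ-< k k<p)))
        where lemma : ∀ k → k ℕ.+ k ≡ 2 ℕ.* k
              lemma = ℕ-solve-∀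

    central-digits-vanish : ∀ k′ → central (k ℕ.+ p ℕ.* k′) ≈ 0ℤ
    central-digits-vanish k′ = ≈-trans (≡⇒≈ (cong (λ t → binom (+ t) (k ℕ.+ p ℕ.* k′)) digits))
                                       (lucas-vanishes e<k k<p (1 ℕ.+ 2 ℕ.* k′) k′)
      where
      open ≡-Reasoning
      lemma : ∀ e p k′ → e ℕ.+ p ℕ.+ 2 ℕ.* (p ℕ.* k′) ≡ e ℕ.+ p ℕ.* (1 ℕ.+ 2 ℕ.* k′)
      lemma = ℕ-solve-∀
      digits : 2 ℕ.* (k ℕ.+ p ℕ.* k′) ≡ e ℕ.+ p ℕ.* (1 ℕ.+ 2 ℕ.* k′)
      digits = begin
        2 ℕ.* (k ℕ.+ p ℕ.* k′)        ≡⟨ ℕ.*-distribˡ-+ 2 k (p ℕ.* k′) ⟩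
        2 ℕ.* k ℕ.+ 2 ℕ.* (p ℕ.* k′)  ≡⟨ cong (ℕ._+ 2 ℕ.* (p ℕ.* k′)) e+p≡2k ⟨
        e ℕ.+ p ℕ.+ 2 ℕ.* (p ℕ.* k′)  ≡⟨ lemma e p k′ ⟩
        e ℕ.+ p ℕ.* (1 ℕ.+ 2 ℕ.* k′)  ∎

    central-vanishes : central k ≈ 0ℤ
    central-vanishes = ≈-trans (≡⇒≈ (cong central (sym (k+p*0≡k k)))) (central-digits-vanish 0)

  central-lucas : ∀ {k} → k < p → ∀ k′ → central (k ℕ.+ p ℕ.* k′) ≈ central k * central k′
  central-lucas {k} k<p k′ with 2 ℕ.* k <? p
  ... | yes 2k<p = ≈-trans (≡⇒≈ (cong (λ t → binom (+ t) (k ℕ.+ p ℕ.* k′)) (lemma k p k′))) (lucasℕ 2k<p k<p (2 ℕ.* k′) k′)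
    where lemma : ∀ k p k′ → 2 ℕ.* (k ℕ.+ p ℕ.* k′) ≡ 2 ℕ.* k ℕ.+ p ℕ.* (2 ℕ.* k′)
          lemma = ℕ-solve-∀
  ... | no  2k≮p = ≈-trans (central-digits-vanish k<p p≤2k k′) (≈-sym (≈0⇒*≈0 (central k′) (central-vanishes k<p p≤2k)))
    where p≤2k = ℕ.≮⇒≥ 2k≮p

  weight-≈0 : ∀ n k → + (n C k) ≈ 0ℤ → weight n k ≈ 0ℤ
  weight-≈0 n k nCk≈0 = ≈0⇒*≈0 (central (n ∸ k)) (≈0⇒*≈0 (central k) (≈0⇒*≈0′ (-1ℤ ^ k) nCk≈0))

  ∸-digits : ∀ {d m k₀ k′} → k₀ ≤ d → k′ ≤ m → (d ℕ.+ p ℕ.* m) ∸ (k₀ ℕ.+ p ℕ.* k′) ≡ (d ∸ k₀) ℕ.+ p ℕ.* (m ∸ k′)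
  ∸-digits {d} {m} {k₀} {k′} k₀≤d k′≤m = begin
    (d ℕ.+ p ℕ.* m) ∸ k
      ≡⟨ cong₂ (λ u v → (u ℕ.+ p ℕ.* v) ∸ k) (ℕ.m∸n+n≡m k₀≤d) (ℕ.m∸n+n≡m k′≤m) ⟨
    ((d ∸ k₀ ℕ.+ k₀) ℕ.+ p ℕ.* (m ∸ k′ ℕ.+ k′)) ∸ k
      ≡⟨ cong (_∸ k) (lemma (d ∸ k₀) k₀ (m ∸ k′) k′ p) ⟩
    ((d ∸ k₀) ℕ.+ p ℕ.* (m ∸ k′) ℕ.+ k) ∸ k
      ≡⟨ ℕ.m+n∸n≡m ((d ∸ k₀) ℕ.+ p ℕ.* (m ∸ k′)) k ⟩
    (d ∸ k₀) ℕ.+ p ℕ.* (m ∸ k′)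
      ∎
    where
    open ≡-Reasoning
    k = k₀ ℕ.+ p ℕ.* k′
    lemma : ∀ j₀ k₀ j′ k′ p → (j₀ ℕ.+ k₀) ℕ.+ p ℕ.* (j′ ℕ.+ k′) ≡ (j₀ ℕ.+ p ℕ.* j′) ℕ.+ (k₀ ℕ.+ p ℕ.* k′)
    lemma = ℕ-solve-∀

  weight-lucas : ∀ {d k₀} → d < p → k₀ < p → ∀ m k′ → weight (d ℕ.+ p ℕ.* m) (k₀ ℕ.+ p ℕ.* k′) ≈ weight d k₀ * weight m k′
  weight-lucas {d} {k₀} d<p k₀<p m k′ with k₀ ≤? d | k′ ≤? m
  ... | no k₀≰d | _ = ≈-trans (weight-≈0 (d ℕ.+ p ℕ.* m) (k₀ ℕ.+ p ℕ.* k′) (lucas-vanishes (ℕ.≰⇒> k₀≰d) k₀<p m k′))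
                              (≡⇒≈ (sym (trans (cong (_* weight m k′) (weight-vanishes (ℕ.≰⇒> k₀≰d))) (ℤ.*-zeroˡ (weight m k′)))))
  ... | yes _ | no k′≰m = ≡⇒≈ (trans (weight-vanishes n<k) (sym (trans (cong (weight d k₀ *_) (weight-vanishes (ℕ.≰⇒> k′≰m))) (ℤ.*-zeroʳ (weight d k₀)))))
    where
    n<k : d ℕ.+ p ℕ.* m < k₀ ℕ.+ p ℕ.* k′
    n<k = ℕ.<-≤-trans (ℕ.+-monoˡ-< (p ℕ.* m) d<p)
                      (ℕ.≤-trans (ℕ.≤-reflexive (sym (ℕ.*-suc p m))) (ℕ.≤-trans (ℕ.*-monoʳ-≤ p (ℕ.≰⇒> k′≰m)) (ℕ.m≤n+m (p ℕ.* k′) k₀)))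
  ... | yes k₀≤d | yes k′≤m = begin
    (-1ℤ ^ k) * + (n C k) * central k * central (n ∸ k)
      ≡⟨ cong (λ t → (-1ℤ ^ k) * + (n C k) * central k * central t) (∸-digits k₀≤d k′≤m) ⟩
    (-1ℤ ^ k) * + (n C k) * central k * central (j₀ ℕ.+ p ℕ.* j′)
      ≈⟨ *-cong (*-cong (*-cong (sign-lucas k₀<p k′) (lucasℕ d<p k₀<p m k′)) (central-lucas k₀<p k′)) (central-lucas j₀<p j′) ⟩
    (s₀ * s′) * (C₀ * C′) * (c₀ * c′) * (cj₀ * cj′)
      ≡⟨ lemma s₀ s′ C₀ C′ c₀ c′ cj₀ cj′ ⟩
    weight d k₀ * weight m k′
      ∎
    where
    open ≈-Reasoning
    n = d ℕ.+ p ℕ.* m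
    k = k₀ ℕ.+ p ℕ.* k′
    j₀ = d ∸ k₀
    j′ = m ∸ k′
    j₀<p = ℕ.≤-<-trans (ℕ.m∸n≤m d k₀) d<p
    s₀ = -1ℤ ^ k₀
    s′ = -1ℤ ^ k′
    C₀ = + (d C k₀)
    C′ = + (m C k′)
    c₀ = central k₀
    c′ = central k′
    cj₀ = central j₀
    cj′ = central j′
    lemma : ∀ s₀ s′ C₀ C′ c₀ c′ cj₀ cj′ → (s₀ * s′) * (C₀ * C′) * (c₀ * c′) * (cj₀ * cj′) ≡ (s₀ * C₀ * c₀ * cj₀) * (s′ * C′ * c′ * cj′)
    lemma = solve-∀

  weight-vanishes-unless-small : ∀ {d} → d < p → ∀ k₀ → weight d k₀ ≈ 0ℤ ⊎ (k₀ ≤ d × 2 ℕ.* (d ∸ k₀) < p)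
  weight-vanishes-unless-small {d} d<p k₀ with k₀ ≤? d
  ... | no  k₀≰d = inj₁ (≡⇒≈ (weight-vanishes (ℕ.≰⇒> k₀≰d)))
  ... | yes k₀≤d with 2 ℕ.* (d ∸ k₀) <? p
  ...   | yes small = inj₂ (k₀≤d , small)
  ...   | no  large = inj₁ (≈0⇒*≈0′ ((-1ℤ ^ k₀) * + (d C k₀) * central k₀)
                                   (central-vanishes (ℕ.≤-<-trans (ℕ.m∸n≤m d k₀) d<p) (ℕ.≮⇒≥ large)))

  top-digits : ∀ d m k₀ k′ → top (d ℕ.+ p ℕ.* m) (k₀ ℕ.+ p ℕ.* k′) ≡ top d k₀ + P * top m k′
  top-digits d m k₀ k′ = begin
    + (2 ℕ.* (d ℕ.+ p ℕ.* m)) - + (3 ℕ.* (k₀ ℕ.+ p ℕ.* k′))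
      ≡⟨ cong₂ _-_ (trans (ℤ.pos-* 2 (d ℕ.+ p ℕ.* m)) (cong (+ 2 *_) (pos-digits d m)))
                   (trans (ℤ.pos-* 3 (k₀ ℕ.+ p ℕ.* k′)) (cong (+ 3 *_) (pos-digits k₀ k′))) ⟩
    + 2 * (+ d + P * + m) - + 3 * (+ k₀ + P * + k′)
      ≡⟨ lemma (+ d) (+ m) (+ k₀) (+ k′) P ⟩
    (+ 2 * + d - + 3 * + k₀) + P * (+ 2 * + m - + 3 * + k′)
      ≡⟨ cong₂ (λ u v → u + P * v) (cong₂ _-_ (ℤ.pos-* 2 d) (ℤ.pos-* 3 k₀)) (cong₂ _-_ (ℤ.pos-* 2 m) (ℤ.pos-* 3 k′)) ⟨
    top d k₀ + P * top m k′
      ∎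
    where
    open ≡-Reasoning
    lemma : ∀ d m k₀ k′ p → + 2 * (d + p * m) - + 3 * (k₀ + p * k′) ≡ (+ 2 * d - + 3 * k₀) + p * (+ 2 * m - + 3 * k′)
    lemma = solve-∀

  -- When 3k₀ > 2d the low digit of 2n − 3k is 2d − 3k₀ + p, borrowing 1 from the high part.
  borrowTop : ℕ → ℕ → ℕ → ℕ → ℤ
  borrowTop d k₀ m k′ with 3 ℕ.* k₀ ≤? 2 ℕ.* d
  ... | yes _ = top m k′
  ... | no  _ = top m k′ - 1ℤ

  Σ<borrowTerm : ∀ d k₀ m → Σ< (suc m) (λ k′ → weight m k′ * binom (borrowTop d k₀ m k′) m) ≡ s18 m
  Σ<borrowTerm d k₀ m with 3 ℕ.* k₀ ≤? 2 ℕ.* d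
  ... | yes _ = sym (s18≡Σ<term m)
  ... | no  _ = trans (Σ<term⁻≡Σ<term m) (sym (s18≡Σ<term m))

  binom-top-lucas : ∀ {d k₀} → d < p → k₀ ≤ d → 2 ℕ.* (d ∸ k₀) < p → ∀ m k′ →
    binom (top (d ℕ.+ p ℕ.* m) (k₀ ℕ.+ p ℕ.* k′)) (d ℕ.+ p ℕ.* m) ≈ binom (top d k₀) d * binom (borrowTop d k₀ m k′) m
  binom-top-lucas {d} {k₀} d<p k₀≤d small m k′ with 3 ℕ.* k₀ ≤? 2 ℕ.* d
  ... | yes 3k₀≤2d = begin
    binom (top n k) n                         ≡⟨ cong (λ t → binom t n) (top-digits d m k₀ k′) ⟩
    binom (top d k₀ + P * top m k′) n         ≡⟨ cong (λ t → binom (t + P * top m k′) n) (pos-∸ 3k₀≤2d) ⟨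
    binom (+ a + P * top m k′) n              ≈⟨ lucas a<p d<p m (top m k′) ⟩
    binom (+ a) d * binom (top m k′) m        ≡⟨ cong (λ t → binom t d * binom (top m k′) m) (pos-∸ 3k₀≤2d) ⟩
    binom (top d k₀) d * binom (top m k′) m   ∎
    where
    open ≈-Reasoning
    n = d ℕ.+ p ℕ.* m
    k = k₀ ℕ.+ p ℕ.* k′
    a = 2 ℕ.* d ∸ 3 ℕ.* k₀
    a<p : a < p
    a<p = ℕ.≤-<-trans (ℕ.≤-trans (ℕ.∸-monoʳ-≤ (2 ℕ.* d) (ℕ.*-monoˡ-≤ k₀ (ℕ.n≤1+n 2)))
                                 (ℕ.≤-reflexive (sym (ℕ.*-distribˡ-∸ 2 d k₀))))
                      small
  ... | no 3k₀≰2d = begin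
    binom (top n k) n                                   ≡⟨ cong (λ t → binom t n) (top-digits d m k₀ k′) ⟩
    binom (top d k₀ + P * top m k′) n                   ≡⟨ cong (λ t → binom t n) (lemma (top d k₀) P (top m k′)) ⟩
    binom ((top d k₀ + P) + P * (top m k′ - 1ℤ)) n      ≡⟨ cong (λ t → binom (t + P * (top m k′ - 1ℤ)) n) a≡top+P ⟨
    binom (+ a + P * (top m k′ - 1ℤ)) n                 ≈⟨ lucas a<p d<p m (top m k′ - 1ℤ) ⟩
    binom (+ a) d * binom (top m k′ - 1ℤ) m             ≡⟨ cong (λ t → binom t d * binom (top m k′ - 1ℤ) m) a≡top+P ⟩
    binom (top d k₀ + P) d * binom (top m k′ - 1ℤ) m    ≈⟨ *-cong (binom-+p d d<p (top d k₀)) ≈-refl ⟩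
    binom (top d k₀) d * binom (top m k′ - 1ℤ) m        ∎
    where
    open ≈-Reasoning
    n = d ℕ.+ p ℕ.* m
    k = k₀ ℕ.+ p ℕ.* k′
    2d<3k₀ = ℕ.≰⇒> 3k₀≰2d
    b = 3 ℕ.* k₀ ∸ 2 ℕ.* d
    b≤k₀ : b ≤ k₀
    b≤k₀ = ℕ.≤-trans (ℕ.∸-monoʳ-≤ (3 ℕ.* k₀) (ℕ.*-monoʳ-≤ 2 k₀≤d)) (ℕ.≤-reflexive (ℕ.m+n∸n≡m k₀ (2 ℕ.* k₀)))
    b<p : b < p
    b<p = ℕ.≤-<-trans b≤k₀ (ℕ.≤-<-trans k₀≤d d<p)
    a = p ∸ b
    a<p : a < p
    a<p = ℕ.∸-monoʳ-< {p} {b} {0} (ℕ.m<n⇒0<n∸m 2d<3k₀) (ℕ.<⇒≤ b<p)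
    a≡top+P : + a ≡ top d k₀ + P
    a≡top+P = trans (pos-∸ (ℕ.<⇒≤ b<p))
                    (trans (cong (λ t → P - t) (pos-∸ (ℕ.<⇒≤ 2d<3k₀))) (lemma′ P (+ (3 ℕ.* k₀)) (+ (2 ℕ.* d))))
      where lemma′ : ∀ p u v → p - (u - v) ≡ (v - u) + p
            lemma′ = solve-∀
    lemma : ∀ y p t → y + p * t ≡ (y + p) + p * (t - 1ℤ)
    lemma = solve-∀

  term-lucas : ∀ {d k₀} → d < p → k₀ < p → ∀ m k′ →
    term (d ℕ.+ p ℕ.* m) (k₀ ℕ.+ p ℕ.* k′) ≈ term d k₀ * (weight m k′ * binom (borrowTop d k₀ m k′) m)
  term-lucas {d} {k₀} d<p k₀<p m k′ with weight-vanishes-unless-small d<p k₀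
  ... | inj₁ w≈0 = begin
    weight n k * binom (top n k) n   ≈⟨ ≈0⇒*≈0 (binom (top n k) n) (≈-trans (weight-lucas d<p k₀<p m k′) (≈0⇒*≈0 (weight m k′) w≈0)) ⟩
    0ℤ                               ≈⟨ ≈0⇒*≈0 (weight m k′ * binom (borrowTop d k₀ m k′) m) (≈0⇒*≈0 (binom (top d k₀) d) w≈0) ⟨
    term d k₀ * (weight m k′ * binom (borrowTop d k₀ m k′) m) ∎
    where
    open ≈-Reasoning
    n = d ℕ.+ p ℕ.* m
    k = k₀ ℕ.+ p ℕ.* k′
  ... | inj₂ (k₀≤d , small) = begin
    weight n k * binom (top n k) n
      ≈⟨ *-cong (weight-lucas d<p k₀<p m k′) (binom-top-lucas d<p k₀≤d small m k′) ⟩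
    weight d k₀ * weight m k′ * (binom (top d k₀) d * binom (borrowTop d k₀ m k′) m)
      ≡⟨ lemma (weight d k₀) (weight m k′) (binom (top d k₀) d) (binom (borrowTop d k₀ m k′) m) ⟩
    term d k₀ * (weight m k′ * binom (borrowTop d k₀ m k′) m)
      ∎
    where
    open ≈-Reasoning
    n = d ℕ.+ p ℕ.* m
    k = k₀ ℕ.+ p ℕ.* k′
    lemma : ∀ w₀ w′ b₀ b′ → w₀ * w′ * (b₀ * b′) ≡ w₀ * b₀ * (w′ * b′)
    lemma = solve-∀

  s18-lucas-step : ∀ {d} → d < p → ∀ m → s18 (d ℕ.+ p ℕ.* m) ≈ s18 d * s18 m
  s18-lucas-step {d} d<p m = begin
    s18 n
      ≡⟨ s18≡Σ<term n ⟩
    Σ< (suc n) (term n)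
      ≡⟨ Σ<-extend (term n) n<p[m+1] (λ k n<k → term-vanishes n<k) ⟨
    Σ< (p ℕ.* suc m) (term n)
      ≡⟨ Σ<-blocks p (suc m) (term n) ⟩
    Σ< (suc m) (λ k′ → Σ< p (λ k₀ → term n (k₀ ℕ.+ p ℕ.* k′)))
      ≈⟨ Σ<-cong≈ (suc m) (λ k′ _ → Σ<-cong≈ p (λ k₀ k₀<p → term-lucas d<p k₀<p m k′)) ⟩
    Σ< (suc m) (λ k′ → Σ< p (λ k₀ → term d k₀ * X k₀ k′))
      ≡⟨ Σ<-swap (suc m) p (λ k′ k₀ → term d k₀ * X k₀ k′) ⟩
    Σ< p (λ k₀ → Σ< (suc m) (λ k′ → term d k₀ * X k₀ k′))
      ≡⟨ Σ<-cong p (λ k₀ _ → trans (sym (Σ<-distribˡ (suc m) (term d k₀) (X k₀))) (cong (term d k₀ *_) (Σ<borrowTerm d k₀ m))) ⟩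
    Σ< p (λ k₀ → term d k₀ * s18 m)
      ≡⟨ Σ<-distribʳ p (s18 m) (term d) ⟨
    Σ< p (term d) * s18 m
      ≡⟨ cong (_* s18 m) (trans (Σ<-extend (term d) d<p (λ k d<k → term-vanishes d<k)) (sym (s18≡Σ<term d))) ⟩
    s18 d * s18 m
      ∎
    where
    open ≈-Reasoning
    n = d ℕ.+ p ℕ.* m
    X : ℕ → ℕ → ℤ
    X k₀ k′ = weight m k′ * binom (borrowTop d k₀ m k′) m
    n<p[m+1] : suc n ≤ p ℕ.* suc m
    n<p[m+1] = ℕ.≤-trans (ℕ.+-monoˡ-< (p ℕ.* m) d<p) (ℕ.≤-reflexive (sym (ℕ.*-suc p m)))

  s18-lucas : ∀ ds → All (_< p) ds → s18 (baseVal p ds) ≈ prodS18 ds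
  s18-lucas []       []           = ≈-refl
  s18-lucas (d ∷ ds) (d<p ∷ ds<p) = ≈-trans (s18-lucas-step d<p (baseVal p ds)) (*-cong (≈-refl {s18 d}) (s18-lucas ds ds<p))

corollary4p2 : (p : ℕ) → Prime p → (ds : List ℕ) → All (_< p) ds →
    (+ p) ∣ (s18 (baseVal p ds) - prodS18 ds)
corollary4p2 zero      p-prime = contradiction p-prime ¬prime[0]
corollary4p2 (suc p-1) p-prime ds ds<p = ∣⇒∣ᵤ (_≈_.divides-difference (s18-lucas ds ds<p))
  where open Lucas p-1 p-prime using (_≈_; s18-lucas)
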